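{- Let $P$ be an integer and $p>3$ a prime. Then the sequence $[P,1]$ (i.e. $F_0=0$, $F_1=1$, $F_{n+1}=PF_n-F_{n-1}$ for $n\ge1$) is complete modulo $p$ if and only if $P\equiv \pm 2 \pmod p$.
   Context: A sequence $\{F_n\}_{n\ge 0}$ of integers is complete modulo a prime $p$ if for every integer $k$ there exists $n\ge 0$ with $F_n\equiv k \pmod p$. -}

module Defs where

open import Data.Nat as ℕ using (ℕ; zero; suc)
open import Data.Integer using (ℤ; +_; _+_; _-_; _*_; -_)
open import Data.Integer.Divisibility using (_∣_)
open import Data.Product using (∃)

lucasU : ℤ → ℕ → ℤ
lucasU P zero = + 0
lucasU P (suc zero) = + 1
lucasU P (suc (suc n)) = P * lucasU P (suc n) - lucasU P n

_≡_[mod_] : ℤ → ℤ → ℕ → Set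
a ≡ b [mod m ] = (+ m) ∣ (a - b)

CompleteMod : (ℕ → ℤ) → ℕ → Set
CompleteMod F p = ∀ (k : ℤ) → ∃ λ n → F n ≡ k [mod p ]

-- Sufficiency is explicit: U n = n for P = 2 and U n = (−1)^(n+1) n for
-- P = −2, and U depends on P only modulo p, so a suitable (odd) index
-- represents any residue.
--
-- Necessity rests on the invariant U n² − P U n U (n+1) + U (n+1)² = 1:
-- every pair (U n, U (n+1)) lies on the conic x² − Pxy + y² = 1.  If P ≈ 0
-- only the residues 0, ±1 occur.  Otherwise (P ≉ 0, ±2) parametrise the
-- conic by lines through its point (0, 1): a second point (x, y), x ≉ 0,
-- on the line of slope t satisfies A t · x + B t ≈ 0, where
-- B t² − 4 A t = P² − 4 ≉ 0.  So a slope determines its point, and the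
-- slope P/2 has none.  Completeness provides points with all abscissae
-- 2, …, p − 1, plus (1, 0) and (1, P); these p points and the slope P/2
-- give p + 1 incongruent residues modulo p, contradicting pigeonhole.

module Submission where

open import Defs
open import Data.Nat using (ℕ; _>_)
open import Data.Nat.Primality using (Prime)
open import Data.Integer using (ℤ; +_; -_)
open import Data.Sum using (_⊎_)
open import Function.Bundles using (_⇔_)

import Data.Nat as ℕ
import Data.Nat.Properties as ℕₚ
open import Data.Nat using (zero; suc; NonZero; _<_; z<s)
open import Data.Nat.Divisibility using (_∣?_; >⇒∤) renaming (_∣_ to _∣ℕ_)
open import Data.Nat.Primality using (euclidsLemma; prime⇒nonZero)
open import Data.Nat.Coprimality using (prime⇒coprime; coprime-Bézout)
open import Data.Nat.GCD using (module Bézout)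
open import Data.Integer using (_+_; _-_; _*_; 0ℤ; 1ℤ; ∣_∣; _⊖_)
import Data.Integer.Properties as ℤₚ
open import Data.Integer.Divisibility.Signed
  using (_∣_; divides; ∣ᵤ⇒∣; ∣⇒∣ᵤ; ∣m⇒∣-m; ∣m∣n⇒∣m+n; ∣m⇒∣m*n; ∣n⇒∣m*n)
open import Data.Integer.DivMod using (_%ℕ_; _/ℕ_; n%ℕd<d; a≡a%ℕn+[a/ℕn]*n)
open import Data.Integer.Tactic.RingSolver using (solve-∀)
import Data.Fin as Fin
open import Data.Fin using (Fin; toℕ; fromℕ<)
open import Data.Fin.Properties using (pigeonhole; toℕ-fromℕ<; toℕ<n; toℕ-injective; <⇒≢)
open import Data.Vec.Functional using (_∷_)
open import Data.Product using (∃; Σ; _,_; proj₁; proj₂; _×_)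
open import Data.Sum using (inj₁; inj₂; [_,_]′) renaming (map to ⊎-map)
open import Data.Empty using (⊥; ⊥-elim)
open import Level using (0ℓ)
open import Relation.Binary.Bundles using (Setoid)
open import Relation.Binary.Definitions using (Decidable)
open import Relation.Binary.PropositionalEquality
  using (_≡_; _≢_; refl; sym; trans; cong; cong₂; subst; module ≡-Reasoning)
open import Relation.Nullary using (¬_; yes; no)
open import Relation.Nullary.Decidable using (map′)
import Relation.Binary.Reasoning.Setoid
open import Function.Bundles using (mk⇔)

conic : ℤ → ℤ → ℤ → ℤ
conic P x y = x * x - P * x * y + y * y

conic-step : ∀ P x y → conic P y (P * y - x) ≡ conic P x y
conic-step = expanded
  where
  expanded : ∀ P x y → y * y - P * y * (P * y - x) + (P * y - x) * (P * y - x)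
                       ≡ x * x - P * x * y + y * y
  expanded = solve-∀

conic-symmetric : ∀ P x y → conic P y x ≡ conic P x y
conic-symmetric = expanded
  where
  expanded : ∀ P x y → y * y - P * y * x + x * x ≡ x * x - P * x * y + y * y
  expanded = solve-∀

lucas-conic : ∀ P n → conic P (lucasU P n) (lucasU P (suc n)) ≡ 1ℤ
lucas-conic P zero = initial P
  where
  initial : ∀ P → + 0 * + 0 - P * + 0 * + 1 + + 1 * + 1 ≡ 1ℤ
  initial = solve-∀
lucas-conic P (suc n) = trans (conic-step P (lucasU P n) (lucasU P (suc n))) (lucas-conic P n)

lucas-two : ∀ n → lucasU (+ 2) n ≡ + n
lucas-two zero = refl
lucas-two (suc zero) = refl
lucas-two (suc (suc n)) = begin
  + 2 * lucasU (+ 2) (suc n) - lucasU (+ 2) n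
    ≡⟨ cong₂ (λ a b → + 2 * a - b) (lucas-two (suc n)) (lucas-two n) ⟩
  + 2 * (+ 1 + + n) - + n
    ≡⟨ step (+ n) ⟩
  + 2 + + n
    ≡⟨ ℤₚ.pos-+ 2 n ⟨
  + suc (suc n) ∎
  where
  open ≡-Reasoning
  step : ∀ x → + 2 * (+ 1 + x) - x ≡ + 2 + x
  step = solve-∀

altSign : ℕ → ℤ
altSign zero = - 1ℤ
altSign (suc n) = - altSign n

altSign-odd : ∀ k → altSign (suc (k ℕ.+ k)) ≡ 1ℤ
altSign-odd zero = refl
altSign-odd (suc k) rewrite ℕₚ.+-suc k k = cong (λ s → - - s) (altSign-odd k)

lucas-negate : ∀ P n → lucasU (- P) n ≡ altSign n * lucasU P n
lucas-negate P zero = refl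
lucas-negate P (suc zero) = refl
lucas-negate P (suc (suc n)) = begin
  - P * lucasU (- P) (suc n) - lucasU (- P) n
    ≡⟨ cong₂ (λ a b → - P * a - b) (lucas-negate P (suc n)) (lucas-negate P n) ⟩
  - P * (- altSign n * lucasU P (suc n)) - altSign n * lucasU P n
    ≡⟨ step P (altSign n) (lucasU P (suc n)) (lucasU P n) ⟩
  - - altSign n * (P * lucasU P (suc n) - lucasU P n) ∎
  where
  open ≡-Reasoning
  step : ∀ P s a b → - P * (- s * a) - s * b ≡ - - s * (P * a - b)
  step = solve-∀

lift-bézout : ∀ a b c d → 1 ℕ.+ a ℕ.* b ≡ c ℕ.* d → 1ℤ + + a * + b ≡ + c * + d
lift-bézout a b c d eq = begin
  1ℤ + + a * + b    ≡⟨ cong (λ z → 1ℤ + z) (ℤₚ.pos-* a b) ⟨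
  1ℤ + + (a ℕ.* b)  ≡⟨ ℤₚ.pos-+ 1 (a ℕ.* b) ⟨
  + (1 ℕ.+ a ℕ.* b) ≡⟨ cong +_ eq ⟩
  + (c ℕ.* d)       ≡⟨ ℤₚ.pos-* c d ⟩
  + c * + d         ∎
  where open ≡-Reasoning

module Congruence (m : ℕ) where

  infix 4 _≈_ _≉_ _≈?_

  -- a ≈ b means m divides a − b.  The record wrapper makes the relation
  -- injective in a and b, so that both sides can be inferred.
  record _≈_ (a b : ℤ) : Set where
    constructor ≈-intro
    field multiple : + m ∣ a - b

  _≉_ : ℤ → ℤ → Set
  a ≉ b = ¬ a ≈ b

  ≈⇒mod : ∀ {a b} → a ≈ b → a ≡ b [mod m ]
  ≈⇒mod (≈-intro d) = ∣⇒∣ᵤ d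

  mod⇒≈ : ∀ {a b} → a ≡ b [mod m ] → a ≈ b
  mod⇒≈ d = ≈-intro (∣ᵤ⇒∣ d)

  _≈?_ : Decidable _≈_
  a ≈? b = map′ mod⇒≈ ≈⇒mod (m ∣? ∣ a - b ∣)

  ≈-via : ∀ {a b c} → + m ∣ c → c ≡ a - b → a ≈ b
  ≈-via d refl = ≈-intro d

  ≈-refl : ∀ {a} → a ≈ a
  ≈-refl {a} = ≈-via (divides 0ℤ refl) (sym (ℤₚ.+-inverseʳ a))

  ≈-reflexive : ∀ {a b} → a ≡ b → a ≈ b
  ≈-reflexive refl = ≈-refl

  ≈-sym : ∀ {a b} → a ≈ b → b ≈ a
  ≈-sym {a} {b} (≈-intro d) = ≈-via (∣m⇒∣-m d) (identity a b)
    where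
    identity : ∀ a b → - (a - b) ≡ b - a
    identity = solve-∀

  ≈-trans : ∀ {a b c} → a ≈ b → b ≈ c → a ≈ c
  ≈-trans {a} {b} {c} (≈-intro d) (≈-intro e) = ≈-via (∣m∣n⇒∣m+n d e) (ℤₚ.+-minus-telescope a b c)

  ≈-setoid : Setoid 0ℓ 0ℓ
  ≈-setoid = record
    { Carrier = ℤ
    ; _≈_ = _≈_
    ; isEquivalence = record { refl = ≈-refl ; sym = ≈-sym ; trans = ≈-trans }
    }

  module ≈-Reasoning = Relation.Binary.Reasoning.Setoid ≈-setoid

  +-cong : ∀ {a b c d} → a ≈ b → c ≈ d → a + c ≈ b + d
  +-cong {a} {b} {c} {d} (≈-intro e) (≈-intro f) = ≈-via (∣m∣n⇒∣m+n e f) (identity a b c d)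
    where
    identity : ∀ a b c d → (a - b) + (c - d) ≡ (a + c) - (b + d)
    identity = solve-∀

  neg-cong : ∀ {a b} → a ≈ b → - a ≈ - b
  neg-cong {a} {b} (≈-intro e) = ≈-via (∣m⇒∣-m e) (identity a b)
    where
    identity : ∀ a b → - (a - b) ≡ - a - - b
    identity = solve-∀

  -‿cong : ∀ {a b c d} → a ≈ b → c ≈ d → a - c ≈ b - d
  -‿cong a≈b c≈d = +-cong a≈b (neg-cong c≈d)

  *-cong : ∀ {a b c d} → a ≈ b → c ≈ d → a * c ≈ b * d
  *-cong {a} {b} {c} {d} (≈-intro e) (≈-intro f) =
    ≈-via (∣m∣n⇒∣m+n (∣m⇒∣m*n c e) (∣n⇒∣m*n b f)) (identity a b c d)
    where
    identity : ∀ a b c d → (a - b) * c + b * (c - d) ≡ a * c - b * d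
    identity = solve-∀

  difference-zero : ∀ {a b} → a - b ≈ 0ℤ → a ≈ b
  difference-zero {a} {b} (≈-intro e) = ≈-via e (ℤₚ.+-identityʳ (a - b))

  residue : .{{_ : NonZero m}} → ∀ k → k ≈ + (k %ℕ m)
  residue k = ≈-via (divides (k /ℕ m) refl) (begin
    (k /ℕ m) * + m                          ≡⟨ identity (+ (k %ℕ m)) ((k /ℕ m) * + m) ⟩
    (+ (k %ℕ m) + (k /ℕ m) * + m) - + (k %ℕ m) ≡⟨ cong (_- + (k %ℕ m)) (a≡a%ℕn+[a/ℕn]*n k m) ⟨
    k - + (k %ℕ m) ∎)
    where
    open ≡-Reasoning
    identity : ∀ r q → q ≡ (r + q) - r
    identity = solve-∀

  ≈0⇒∣abs : ∀ {a} → a ≈ 0ℤ → m ∣ℕ ∣ a ∣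
  ≈0⇒∣abs {a} a≈0 = subst (λ b → m ∣ℕ ∣ b ∣) (ℤₚ.+-identityʳ a) (≈⇒mod a≈0)

  ∣abs⇒≈0 : ∀ {a} → m ∣ℕ ∣ a ∣ → a ≈ 0ℤ
  ∣abs⇒≈0 {a} m∣a = mod⇒≈ (subst (λ b → m ∣ℕ ∣ b ∣) (sym (ℤₚ.+-identityʳ a)) m∣a)

  below-injective : ∀ {a b} → a < m → b < m → + a ≈ + b → a ≡ b
  below-injective {a} {b} a<m b<m a≈b =
    ℤₚ.+-injective (ℤₚ.i-j≡0⇒i≡j (+ a) (+ b) (ℤₚ.∣i∣≡0⇒i≡0 (multiple-below-zero distance<m (≈⇒mod a≈b))))
    where
    multiple-below-zero : ∀ {d} → d < m → m ∣ℕ d → d ≡ 0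
    multiple-below-zero {zero} _ _ = refl
    multiple-below-zero {suc d} d<m m∣d = ⊥-elim (>⇒∤ d<m m∣d)

    distance<m : ∣ + a - + b ∣ < m
    distance<m = begin-strict
      ∣ + a - + b ∣ ≡⟨ cong ∣_∣ (ℤₚ.m-n≡m⊖n a b) ⟩
      ∣ a ⊖ b ∣     ≤⟨ ℤₚ.∣m⊝n∣≤m⊔n a b ⟩
      a ℕ.⊔ b       <⟨ ℕₚ.⊔-pres-<m a<m b<m ⟩
      m             ∎
      where open ℕₚ.≤-Reasoning

  Incongruent : ∀ {n} → (Fin n → ℤ) → Set
  Incongruent f = ∀ i j → f i ≈ f j → i ≡ j

  extend-incongruent : ∀ {n a} {f : Fin n → ℤ} → (∀ i → a ≉ f i) → Incongruent f → Incongruent (a ∷ f)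
  extend-incongruent fresh inj Fin.zero Fin.zero _ = refl
  extend-incongruent fresh inj Fin.zero (Fin.suc j) e = ⊥-elim (fresh j e)
  extend-incongruent fresh inj (Fin.suc i) Fin.zero e = ⊥-elim (fresh i (≈-sym e))
  extend-incongruent fresh inj (Fin.suc i) (Fin.suc j) e = cong Fin.suc (inj i j e)

  pigeonhole-mod : .{{_ : NonZero m}} → (f : Fin (suc m) → ℤ) → ¬ Incongruent f
  pigeonhole-mod f inj = collision (pigeonhole (ℕₚ.n<1+n m) residueOf)
    where
    open ≈-Reasoning
    residueOf : Fin (suc m) → Fin m
    residueOf i = fromℕ< (n%ℕd<d (f i) m)

    same-residue : ∀ i j → residueOf i ≡ residueOf j → f i %ℕ m ≡ f j %ℕ m
    same-residue i j eq =
      trans (sym (toℕ-fromℕ< (n%ℕd<d (f i) m))) (trans (cong toℕ eq) (toℕ-fromℕ< (n%ℕd<d (f j) m)))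

    collision : (∃ λ i → ∃ λ j → i Fin.< j × residueOf i ≡ residueOf j) → ⊥
    collision (i , j , i<j , same) = <⇒≢ i<j (inj i j (begin
      f i                 ≈⟨ residue (f i) ⟩
      + (f i %ℕ m)        ≡⟨ cong +_ (same-residue i j same) ⟩
      + (f j %ℕ m)        ≈⟨ residue (f j) ⟨
      f j                 ∎))

module LucasModulo (m : ℕ) where
  open Congruence m

  lucas-cong : ∀ {P Q} → P ≈ Q → ∀ n → lucasU P n ≈ lucasU Q n
  lucas-cong P≈Q zero = ≈-refl
  lucas-cong P≈Q (suc zero) = ≈-refl
  lucas-cong P≈Q (suc (suc n)) = -‿cong (*-cong P≈Q (lucas-cong P≈Q (suc n))) (lucas-cong P≈Q n)

  skip-two : ∀ {P} → P ≈ 0ℤ → ∀ n → lucasU P (suc (suc n)) ≈ - lucasU P n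
  skip-two P≈0 n = ≈-trans (-‿cong (*-cong P≈0 ≈-refl) ≈-refl) (≈-reflexive (ℤₚ.+-identityˡ _))

  lucas-at-zero : ∀ {P} → P ≈ 0ℤ → ∀ n → lucasU P n ≈ 0ℤ ⊎ lucasU P n ≈ 1ℤ ⊎ lucasU P n ≈ - 1ℤ
  lucas-at-zero P≈0 zero = inj₁ ≈-refl
  lucas-at-zero P≈0 (suc zero) = inj₂ (inj₁ ≈-refl)
  lucas-at-zero P≈0 (suc (suc n)) with lucas-at-zero P≈0 n
  ... | inj₁ U≈0 = inj₁ (≈-trans (skip-two P≈0 n) (neg-cong U≈0))
  ... | inj₂ (inj₁ U≈1) = inj₂ (inj₂ (≈-trans (skip-two P≈0 n) (neg-cong U≈1)))
  ... | inj₂ (inj₂ U≈-1) = inj₂ (inj₁ (≈-trans (skip-two P≈0 n) (neg-cong U≈-1)))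

module PrimeModulus (p : ℕ) (p-prime : Prime p) where
  open Congruence p public
  open LucasModulo p public
  open ≈-Reasoning

  instance
    p-nonZero : NonZero p
    p-nonZero = prime⇒nonZero p-prime

  small-nonzero : ∀ {a} → 0 < a → a < p → + a ≉ 0ℤ
  small-nonzero 0<a a<p a≈0 = ℕₚ.<⇒≢ 0<a (sym (below-injective a<p (ℕₚ.<-trans 0<a a<p) a≈0))

  product-zero : ∀ {a b} → a * b ≈ 0ℤ → a ≈ 0ℤ ⊎ b ≈ 0ℤ
  product-zero {a} {b} ab≈0
    with euclidsLemma ∣ a ∣ ∣ b ∣ p-prime (subst (p ∣ℕ_) (ℤₚ.abs-* a b) (≈0⇒∣abs ab≈0))
  ... | inj₁ p∣a = inj₁ (∣abs⇒≈0 p∣a)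
  ... | inj₂ p∣b = inj₂ (∣abs⇒≈0 p∣b)

  cancel : ∀ {a b} → a ≉ 0ℤ → a * b ≈ 0ℤ → b ≈ 0ℤ
  cancel a≉0 ab≈0 with product-zero ab≈0
  ... | inj₁ a≈0 = ⊥-elim (a≉0 a≈0)
  ... | inj₂ b≈0 = b≈0

  invertible : ∀ {r} → 0 < r → r < p → ∃ λ u → u * + r ≈ 1ℤ
  invertible {r} 0<r r<p with coprime-Bézout (prime⇒coprime p-prime {{ℕ.>-nonZero 0<r}} r<p)
  -- 1 + y r = x p gives (−y) r − 1 = −(x p)
  ... | Bézout.+- x y eq = - + y , ≈-via (∣m⇒∣-m (divides (+ x) refl))
      (trans (cong -_ (sym (lift-bézout y r x p eq))) (negated (+ y) (+ r)))
    where
    negated : ∀ y r → - (1ℤ + y * r) ≡ - y * r - 1ℤ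
    negated = solve-∀
  -- 1 + x p = y r gives y r − 1 = x p
  ... | Bézout.-+ x y eq = + y , ≈-via (divides (+ x) refl)
      (trans (shifted (+ x * + p)) (cong (_- 1ℤ) (lift-bézout x p y r eq)))
    where
    shifted : ∀ a → a ≡ (1ℤ + a) - 1ℤ
    shifted = solve-∀

  division : ∀ {a} → a ≉ 0ℤ → ∀ c → ∃ λ t → t * a ≈ c
  division {a} a≉0 c = c * u , (begin
    c * u * a      ≡⟨ ℤₚ.*-assoc c u a ⟩
    c * (u * a)    ≈⟨ *-cong (≈-refl {c}) ua≈1 ⟩
    c * 1ℤ         ≡⟨ ℤₚ.*-identityʳ c ⟩
    c              ∎)
    where
    r = a %ℕ p
    r≢0 : r ≢ 0
    r≢0 r≡0 = a≉0 (≈-trans (residue a) (≈-reflexive (cong +_ r≡0)))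
    inverse = invertible (ℕₚ.n≢0⇒n>0 r≢0) (n%ℕd<d a p)
    u = proj₁ inverse
    ua≈1 : u * a ≈ 1ℤ
    ua≈1 = ≈-trans (*-cong (≈-refl {u}) (residue a)) (proj₂ inverse)

module Sufficiency (p : ℕ) (p-prime : Prime p) (2<p : 2 < p) where
  open PrimeModulus p p-prime
  open ≈-Reasoning

  complete-at-two : ∀ {P} → P ≈ + 2 → CompleteMod (lucasU P) p
  complete-at-two {P} P≈2 k = n , ≈⇒mod (begin
    lucasU P n      ≈⟨ lucas-cong P≈2 n ⟩
    lucasU (+ 2) n  ≡⟨ lucas-two n ⟩
    + n             ≈⟨ residue k ⟨
    k               ∎)
    where n = k %ℕ p

  -- As 2 is invertible modulo p, every residue k has an odd representative
  -- 2j + 1, namely with j ≈ (k − 1)/2.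
  odd-representative : ∀ k → ∃ λ j → + suc (j ℕ.+ j) ≈ k
  odd-representative k = j , (begin
    + suc (j ℕ.+ j)            ≡⟨ ℤₚ.pos-+ 1 (j ℕ.+ j) ⟩
    1ℤ + + (j ℕ.+ j)           ≡⟨ cong (λ z → 1ℤ + z) (ℤₚ.pos-+ j j) ⟩
    1ℤ + (+ j + + j)           ≈⟨ +-cong (≈-refl {1ℤ}) (+-cong j≈w j≈w) ⟩
    1ℤ + (w + w)               ≡⟨ doubled h (k - 1ℤ) ⟩
    1ℤ + h * + 2 * (k - 1ℤ)    ≈⟨ +-cong (≈-refl {1ℤ}) (*-cong h2≈1 (≈-refl {k - 1ℤ})) ⟩
    1ℤ + 1ℤ * (k - 1ℤ)         ≡⟨ cancelled k ⟩
    k                          ∎)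
    where
    half = division (small-nonzero z<s 2<p) 1ℤ
    h = proj₁ half
    h2≈1 : h * + 2 ≈ 1ℤ
    h2≈1 = proj₂ half
    w = h * (k - 1ℤ)
    j = w %ℕ p
    j≈w : + j ≈ w
    j≈w = ≈-sym (residue w)
    doubled : ∀ h c → 1ℤ + (h * c + h * c) ≡ 1ℤ + h * + 2 * c
    doubled = solve-∀
    cancelled : ∀ k → 1ℤ + 1ℤ * (k - 1ℤ) ≡ k
    cancelled = solve-∀

  -- For P ≈ −2 the odd-indexed terms satisfy U n ≈ n.
  complete-at-minus-two : ∀ {P} → P ≈ - + 2 → CompleteMod (lucasU P) p
  complete-at-minus-two {P} P≈-2 k = n , ≈⇒mod (begin
    lucasU P n                      ≈⟨ lucas-cong P≈-2 n ⟩
    lucasU (- + 2) n                ≡⟨ lucas-negate (+ 2) n ⟩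
    altSign n * lucasU (+ 2) n      ≡⟨ cong₂ _*_ (altSign-odd j) (lucas-two n) ⟩
    1ℤ * + n                        ≡⟨ ℤₚ.*-identityˡ (+ n) ⟩
    + n                             ≈⟨ proj₂ (odd-representative k) ⟩
    k                               ∎)
    where
    j = proj₁ (odd-representative k)
    n = suc (j ℕ.+ j)

-- Necessity, degenerate case: P ≈ 0 misses the residue 2 when p > 3

module DegenerateCase (p : ℕ) (p-prime : Prime p) (3<p : 3 < p) where
  open PrimeModulus p p-prime

  2<p : 2 < p
  2<p = ℕₚ.<-trans (ℕₚ.n<1+n 2) 3<p

  1<p : 1 < p
  1<p = ℕₚ.<-trans (ℕₚ.n<1+n 1) 2<p

  2≢1 : 2 ≢ 1
  2≢1 ()

  two-outside : ∀ {c} → c ≈ 0ℤ ⊎ c ≈ 1ℤ ⊎ c ≈ - 1ℤ → + 2 ≉ c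
  two-outside (inj₁ c≈0) 2≈c = small-nonzero z<s 2<p (≈-trans 2≈c c≈0)
  two-outside (inj₂ (inj₁ c≈1)) 2≈c = 2≢1 (below-injective 2<p 1<p (≈-trans 2≈c c≈1))
  two-outside (inj₂ (inj₂ c≈-1)) 2≈c = small-nonzero z<s 3<p (+-cong (≈-trans 2≈c c≈-1) (≈-refl {1ℤ}))

  incomplete-at-zero : ∀ {P} → P ≈ 0ℤ → ¬ CompleteMod (lucasU P) p
  incomplete-at-zero P≈0 complete =
    two-outside (lucas-at-zero P≈0 (proj₁ (complete (+ 2)))) (≈-sym (mod⇒≈ (proj₂ (complete (+ 2)))))

-- Necessity, main case: chords of the conic through (0, 1)

module Chords (p : ℕ) (p-prime : Prime p) (2<p : 2 < p) (P : ℤ) where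
  open PrimeModulus p p-prime
  open ≈-Reasoning

  -- Substituting y = t x + 1 into conic P x y − 1 gives x (A t · x + B t).
  A B : ℤ → ℤ
  A t = t * t - P * t + 1ℤ
  B t = + 2 * t - P

  record Chord (t : ℤ) : Set where
    field
      x y : ℤ
      on-conic : conic P x y ≈ 1ℤ
      x≉0 : x ≉ 0ℤ
      on-line : t * x ≈ y - 1ℤ

  chord-through : ∀ {x y} → x ≉ 0ℤ → conic P x y ≈ 1ℤ → Σ ℤ Chord
  chord-through {x} {y} x≉0 on-conic =
    proj₁ slope , record { x = x ; y = y ; on-conic = on-conic ; x≉0 = x≉0 ; on-line = proj₂ slope }
    where slope = division x≉0 (y - 1ℤ)

  chord-respects : ∀ {t t′} → t ≈ t′ → Chord t′ → Chord t
  chord-respects {t} t≈t′ c = record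
    { x = x ; y = y ; on-conic = on-conic ; x≉0 = x≉0
    ; on-line = ≈-trans (*-cong t≈t′ (≈-refl {x})) on-line }
    where open Chord c

  conic-congʳ : ∀ x {y y′} → y ≈ y′ → conic P x y ≈ conic P x y′
  conic-congʳ x y≈y′ = +-cong (-‿cong (≈-refl {x * x}) (*-cong (≈-refl {P * x}) y≈y′)) (*-cong y≈y′ y≈y′)

  chord-equation : ∀ {t} (c : Chord t) → A t * Chord.x c + B t ≈ 0ℤ
  chord-equation {t} c = cancel x≉0 (begin
    x * (A t * x + B t)             ≡⟨ substituted P t x ⟩
    conic P x (t * x + 1ℤ) - 1ℤ     ≈⟨ -‿cong (conic-congʳ x line) (≈-refl {1ℤ}) ⟩
    conic P x y - 1ℤ                ≈⟨ -‿cong on-conic (≈-refl {1ℤ}) ⟩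
    0ℤ                              ∎)
    where
    open Chord c
    line : t * x + 1ℤ ≈ y
    line = ≈-trans (+-cong on-line (≈-refl {1ℤ})) (≈-reflexive (shifted y))
      where
      shifted : ∀ y → y - 1ℤ + 1ℤ ≡ y
      shifted = solve-∀
    substituted : ∀ P t x → x * ((t * t - P * t + 1ℤ) * x + (+ 2 * t - P))
                  ≡ x * x - P * x * (t * x + 1ℤ) + (t * x + 1ℤ) * (t * x + 1ℤ) - 1ℤ
    substituted = solve-∀

  -- The discriminant of A is B² − 4A = (P − 2)(P + 2), so A and B
  -- vanish together only when P ≈ ±2.
  discriminant : ∀ {t} → A t ≈ 0ℤ → B t ≈ 0ℤ → P ≈ + 2 ⊎ P ≈ - + 2
  discriminant {t} A≈0 B≈0 = ⊎-map difference-zero difference-zero (product-zero (begin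
    (P - + 2) * (P - - + 2)    ≡⟨ factored P t ⟩
    B t * B t - + 4 * A t      ≈⟨ -‿cong (*-cong B≈0 B≈0) (*-cong (≈-refl {+ 4}) A≈0) ⟩
    0ℤ                         ∎))
    where
    factored : ∀ P t → (P - + 2) * (P - - + 2)
               ≡ (+ 2 * t - P) * (+ 2 * t - P) - + 4 * (t * t - P * t + 1ℤ)
    factored = solve-∀

  module Nondegenerate (P≉2 : P ≉ + 2) (P≉-2 : P ≉ - + 2) where

    both-vanish : ∀ {t} → A t ≈ 0ℤ → B t ≈ 0ℤ → ⊥
    both-vanish {t} A≈0 B≈0 = [ P≉2 , P≉-2 ]′ (discriminant {t} A≈0 B≈0)

    -- Along a chord A t ≉ 0, for otherwise the chord equation forces B t ≈ 0.
    chord-A≉0 : ∀ {t} → Chord t → A t ≉ 0ℤ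
    chord-A≉0 {t} c A≈0 = both-vanish {t} A≈0 (begin
      B t                         ≡⟨ split (A t) x (B t) ⟩
      (A t * x + B t) - A t * x   ≈⟨ -‿cong (chord-equation c) (*-cong A≈0 (≈-refl {x})) ⟩
      0ℤ                          ∎)
      where
      open Chord c
      split : ∀ a x b → b ≡ (a * x + b) - a * x
      split = solve-∀

    -- Hence the slope where B vanishes (t ≈ P/2) carries no chord ...
    no-chord-at-half : ∀ {t} → B t ≈ 0ℤ → ¬ Chord t
    no-chord-at-half {t} B≈0 c = [ chord-A≉0 c , x≉0 ]′ (product-zero (begin
      A t * x                     ≡⟨ split (A t) x (B t) ⟩
      (A t * x + B t) - B t       ≈⟨ -‿cong (chord-equation c) B≈0 ⟩
      0ℤ                          ∎))
      where
      open Chord c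
      split : ∀ a x b → a * x ≡ (a * x + b) - b
      split = solve-∀

    -- ... and a slope determines its chord: the abscissa is −B t / A t.
    same-chord : ∀ {t} (c c′ : Chord t) → Chord.x c ≈ Chord.x c′ × Chord.y c ≈ Chord.y c′
    same-chord {t} c c′ = x≈x′ , (begin
      y                  ≡⟨ shifted y ⟩
      y - 1ℤ + 1ℤ        ≈⟨ +-cong (≈-sym (Chord.on-line c)) (≈-refl {1ℤ}) ⟩
      t * x + 1ℤ         ≈⟨ +-cong (*-cong (≈-refl {t}) x≈x′) (≈-refl {1ℤ}) ⟩
      t * x′ + 1ℤ        ≈⟨ +-cong (Chord.on-line c′) (≈-refl {1ℤ}) ⟩
      y′ - 1ℤ + 1ℤ       ≡⟨ shifted y′ ⟨
      y′                 ∎)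
      where
      open Chord c using (x; y)
      open Chord c′ using () renaming (x to x′; y to y′)
      shifted : ∀ y → y ≡ y - 1ℤ + 1ℤ
      shifted = solve-∀
      difference : ∀ a b x x′ → a * (x - x′) ≡ (a * x + b) - (a * x′ + b)
      difference = solve-∀
      x≈x′ : x ≈ x′
      x≈x′ = difference-zero (cancel (chord-A≉0 c) (begin
        A t * (x - x′)                         ≡⟨ difference (A t) (B t) x x′ ⟩
        (A t * x + B t) - (A t * x′ + B t)     ≈⟨ -‿cong (chord-equation c) (chord-equation c′) ⟩
        0ℤ                                     ∎))

    same-slope : ∀ {t t′} (c : Chord t) (c′ : Chord t′) → t ≈ t′ →
                 Chord.x c ≈ Chord.x c′ × Chord.y c ≈ Chord.y c′
    same-slope c c′ t≈t′ = same-chord c (chord-respects t≈t′ c′)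

    -- Counting: at most p − 1 chords have pairwise incongruent slopes,
    -- since the residue P/2 is not a chord slope.
    chord-slopes-bound : (c : Fin p → Σ ℤ Chord) → ¬ Incongruent (λ i → proj₁ (c i))
    chord-slopes-bound c incongruent =
      pigeonhole-mod (h ∷ λ i → proj₁ (c i)) (extend-incongruent fresh incongruent)
      where
      half = division (small-nonzero z<s 2<p) P
      h = proj₁ half
      B≈0 : B h ≈ 0ℤ
      B≈0 = begin
        + 2 * h - P    ≡⟨ cong (_- P) (ℤₚ.*-comm (+ 2) h) ⟩
        h * + 2 - P    ≈⟨ -‿cong (proj₂ half) (≈-refl {P}) ⟩
        P - P          ≡⟨ ℤₚ.+-inverseʳ P ⟩
        0ℤ             ∎
      fresh : ∀ i → h ≉ proj₁ (c i)
      fresh i h≈t = no-chord-at-half B≈0 (chord-respects h≈t (proj₂ (c i)))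

    -- A complete sequence with P ≉ 0 yields p chords with incongruent slopes:
    -- the two chords at abscissa 1 through (U 1, U 0) = (1, 0) and
    -- (U 1, U 2) = (1, P), and for each 2 ≤ k < p a chord through a point
    -- (U n, U (n+1)) of the sequence with U n ≈ k.
    module FromCompleteness (P≉0 : P ≉ 0ℤ) (complete : CompleteMod (lucasU P) p) where

      index : ℤ → ℕ
      index k = proj₁ (complete k)

      hits : ∀ k → lucasU P (index k) ≈ k
      hits k = mod⇒≈ (proj₂ (complete k))

      1<p : 1 < p
      1<p = ℕₚ.<-trans (ℕₚ.n<1+n 1) 2<p

      one≉0 : + 1 ≉ 0ℤ
      one≉0 = small-nonzero z<s 1<p

      chordAt : ∀ k → k < p → Σ ℤ Chord
      chordAt zero _ =
        chord-through one≉0 (≈-reflexive (trans (conic-symmetric P (+ 0) (+ 1)) (lucas-conic P 0)))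
      chordAt (suc zero) _ = chord-through one≉0 (≈-reflexive (lucas-conic P 1))
      chordAt k@(suc (suc _)) k<p =
        chord-through (λ U≈0 → small-nonzero z<s k<p (≈-trans (≈-sym (hits (+ k))) U≈0))
                      (≈-reflexive (lucas-conic P (index (+ k))))

      slopeAt : ∀ k → k < p → ℤ
      slopeAt k k<p = proj₁ (chordAt k k<p)

      abscissaAt : ∀ k (k<p : k < p) → Chord.x (proj₂ (chordAt k k<p)) ≈ + (1 ℕ.⊔ k)
      abscissaAt zero _ = ≈-refl
      abscissaAt (suc zero) _ = ≈-refl
      abscissaAt k@(suc (suc _)) _ = hits (+ k)

      same-abscissa : ∀ a b (a<p : a < p) (b<p : b < p) → slopeAt a a<p ≈ slopeAt b b<p → 1 ℕ.⊔ a ≡ 1 ℕ.⊔ b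
      same-abscissa a b a<p b<p e =
        below-injective (ℕₚ.⊔-pres-<m 1<p a<p) (ℕₚ.⊔-pres-<m 1<p b<p) (begin
          + (1 ℕ.⊔ a)                   ≈⟨ abscissaAt a a<p ⟨
          Chord.x (proj₂ (chordAt a a<p)) ≈⟨ proj₁ (same-slope (proj₂ (chordAt a a<p)) (proj₂ (chordAt b b<p)) e) ⟩
          Chord.x (proj₂ (chordAt b b<p)) ≈⟨ abscissaAt b b<p ⟩
          + (1 ℕ.⊔ b)                   ∎)

      ordinates-apart : ∀ (a<p : 0 < p) (b<p : 1 < p) → slopeAt 0 a<p ≉ slopeAt 1 b<p
      ordinates-apart a<p b<p e = P≉0 (begin
        P                  ≡⟨ second-term P ⟩
        P * + 1 - + 0      ≈⟨ proj₂ (same-slope (proj₂ (chordAt 0 a<p)) (proj₂ (chordAt 1 b<p)) e) ⟨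
        0ℤ                 ∎)
        where
        second-term : ∀ P → P ≡ P * + 1 - + 0
        second-term = solve-∀

      one≢2+ : ∀ {j} → 1 ≢ suc (suc j)
      one≢2+ ()

      chordAt-injective : ∀ a b (a<p : a < p) (b<p : b < p) → slopeAt a a<p ≈ slopeAt b b<p → a ≡ b
      chordAt-injective zero zero _ _ _ = refl
      chordAt-injective zero (suc zero) a<p b<p e = ⊥-elim (ordinates-apart a<p b<p e)
      chordAt-injective (suc zero) zero a<p b<p e = ⊥-elim (ordinates-apart b<p a<p (≈-sym e))
      chordAt-injective (suc zero) (suc zero) _ _ _ = refl
      chordAt-injective zero b@(suc (suc _)) a<p b<p e = ⊥-elim (one≢2+ (same-abscissa 0 b a<p b<p e))
      chordAt-injective (suc zero) b@(suc (suc _)) a<p b<p e = ⊥-elim (one≢2+ (same-abscissa 1 b a<p b<p e))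
      chordAt-injective a@(suc (suc _)) zero a<p b<p e = ⊥-elim (one≢2+ (sym (same-abscissa a 0 a<p b<p e)))
      chordAt-injective a@(suc (suc _)) (suc zero) a<p b<p e = ⊥-elim (one≢2+ (sym (same-abscissa a 1 a<p b<p e)))
      chordAt-injective a@(suc (suc _)) b@(suc (suc _)) a<p b<p e = same-abscissa a b a<p b<p e

      chords : Fin p → Σ ℤ Chord
      chords i = chordAt (toℕ i) (toℕ<n i)

      chords-incongruent : Incongruent (λ i → proj₁ (chords i))
      chords-incongruent i j e = toℕ-injective (chordAt-injective (toℕ i) (toℕ j) (toℕ<n i) (toℕ<n j) e)

    incomplete : P ≉ 0ℤ → ¬ CompleteMod (lucasU P) p
    incomplete P≉0 complete = chord-slopes-bound chords chords-incongruent
      where open FromCompleteness P≉0 complete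

theorem2 : (P : ℤ) (p : ℕ) → Prime p → p > 3 →
    (CompleteMod (lucasU P) p ⇔ (P ≡ + 2 [mod p ] ⊎ P ≡ - + 2 [mod p ]))
theorem2 P p p-prime 3<p = mk⇔ necessary sufficient
  where
  open PrimeModulus p p-prime using (mod⇒≈; ≈⇒mod; _≈?_)
  open DegenerateCase p p-prime 3<p using (2<p; incomplete-at-zero)
  open Sufficiency p p-prime 2<p using (complete-at-two; complete-at-minus-two)
  open Chords p p-prime 2<p P using (module Nondegenerate)

  sufficient : P ≡ + 2 [mod p ] ⊎ P ≡ - + 2 [mod p ] → CompleteMod (lucasU P) p
  sufficient (inj₁ P≡2) = complete-at-two (mod⇒≈ P≡2)
  sufficient (inj₂ P≡-2) = complete-at-minus-two (mod⇒≈ P≡-2)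

  necessary : CompleteMod (lucasU P) p → P ≡ + 2 [mod p ] ⊎ P ≡ - + 2 [mod p ]
  necessary complete with P ≈? + 2 | P ≈? - + 2 | P ≈? 0ℤ
  ... | yes P≈2 | _        | _       = inj₁ (≈⇒mod P≈2)
  ... | no _    | yes P≈-2 | _       = inj₂ (≈⇒mod P≈-2)
  ... | no _    | no _     | yes P≈0 = ⊥-elim (incomplete-at-zero P≈0 complete)
  ... | no P≉2  | no P≉-2  | no P≉0  = ⊥-elim (Nondegenerate.incomplete P≉2 P≉-2 P≉0 complete)
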